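{- Let $P$ be a dealing pattern, $N\ge 1$, and let $P'$ be the pattern obtained from $P$ by deleting its first $N$ letters. Then \[E^{P}(N)=\begin{cases}1,& \text{if the first letter of } P \text{ is } D,\\ E^{P'}\bigl(|P_N|_U\bigr)+|P_N|_D, & \text{otherwise.}\end{cases}\]
   Context: A dealing pattern $P=P_1P_2P_3\cdots$ is an infinite sequence of letters $U$ and $D$ containing infinitely many $D$'s. Dealing a deck of $N$ cards (positions $1,\dots,N$ from the top) by $P$ means: process the letters in order; for a $U$ move the top card to the bottom; for a $D$ remove the top card (deal it); stop when all $N$ cards are dealt. $E^P(N)$ is the number $j$ such that the card initially on top of the deck is the $j$th card dealt. $|P_N|_D$, $|P_N|_U$ denote the number of $D$'s, resp. $U$'s, among the first $N$ letters of $P$. -}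

module Defs where

open import Data.Nat using (ℕ; zero; suc; _+_; _∸_; _≤_; _≡ᵇ_)
open import Data.Nat.Properties using (m+[n∸m]≡n; m+n≤o⇒m≤o; ≤-trans; ≤-reflexive; m+n∸m≡n; ∸-monoˡ-≤)
open import Data.Bool using (if_then_else_)
open import Data.List using (List; []; _∷_; _++_; [_]; map; upTo)
open import Data.Product using (Σ; _×_; _,_; proj₁)
open import Relation.Binary.PropositionalEquality using (_≡_; subst; sym)

data Letter : Set where
  U D : Letter

-- A dealing pattern P = P₁ P₂ P₃ ⋯ : letter i is P_{i+1} (0-based indexing),
-- together with the requirement that it contains infinitely many D's.
record Pattern : Set where
  field
    letter : ℕ → Letter
    infD   : ∀ n → Σ ℕ λ m → n ≤ m × letter m ≡ D
open Pattern public

-- Cards are labelled 1..N (label = initial position),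
-- the deck is a list with the top card first. `run fuel p i deck c` processes
-- letters p i, p (i+1), … ; c = number of cards dealt so far. It returns the
-- index j such that card 1 is the j-th card dealt (0 if not dealt within fuel).
run : ℕ → (ℕ → Letter) → ℕ → List ℕ → ℕ → ℕ
run zero     p i deck       c = 0
run (suc f)  p i []         c = 0
run (suc f)  p i (x ∷ xs)   c with p i
... | U = run f p (suc i) (xs ++ [ x ]) c
... | D = if x ≡ᵇ 1 then suc c else run f p (suc i) xs (suc c)

-- Enough fuel: position just after the k-th D (from the infinitely-many-D's proof).
-- After processing `afterDs P N` letters at least N D's have been processed,
-- so a deck of N cards is completely dealt.
afterDs : Pattern → ℕ → ℕ
afterDs P zero    = 0
afterDs P (suc k) = suc (proj₁ (infD P (afterDs P k)))

deck : ℕ → List ℕ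
deck N = map suc (upTo N)

E : Pattern → ℕ → ℕ
E P N = run (afterDs P N) (letter P) 0 (deck N) 0

dropP : ℕ → Pattern → Pattern
letter (dropP N P) n = letter P (N + n)
infD (dropP N P) n with infD P (N + n)
... | m , le , eq =
  m ∸ N , le' , subst (λ k → letter P k ≡ D) (sym (m+[n∸m]≡n (m+n≤o⇒m≤o N le))) eq
  where
  le' : n ≤ m ∸ N
  le' = ≤-trans (≤-reflexive (sym (m+n∸m≡n N n))) (∸-monoˡ-≤ N le)

countD : Pattern → ℕ → ℕ
countD P zero = 0
countD P (suc n) with letter P n
... | D = suc (countD P n)
... | U = countD P n

countU : Pattern → ℕ → ℕ
countU P zero = 0
countU P (suc n) with letter P n
... | U = suc (countU P n)
... | D = countU P n

{-# OPTIONS --safe #-}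
-- Only the card that starts on top matters, so the deck can be replaced by a
-- list of booleans marking that card. If the first letter is U, the marked card
-- goes to the bottom, and each of the next N − 1 letters acts on a different
-- unmarked card: its D's deal cards, its U's send cards behind the marked one.
-- After the first N letters the marked card is thus on top of a deck of
-- |P_N|_U cards, |P_N|_D cards have been dealt, and P' is still to be applied.
module Submission where

open import Defs
open import Data.Nat using (ℕ; zero; suc; _+_; _≥_; _≤_; z≤n; s≤s; s≤s⁻¹; _≡ᵇ_)
open import Data.Nat.Properties
  using (+-suc; +-comm; +-assoc; +-identityʳ; +-monoʳ-≤; m+n≡0⇒m≡0; ≤-trans; ≤-reflexive)
open import Data.Bool using (Bool; true; false; if_then_else_)
open import Data.List using (List; []; _∷_; _++_; [_]; map; applyUpTo; replicate; length)
open import Data.List.Properties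
  using (map-++; map-applyUpTo; ++-assoc; ++-identityʳ; length-++; length-replicate)
open import Data.List.Membership.Propositional using (_∈_)
open import Data.List.Relation.Unary.Any using (here; there)
import Data.List.Relation.Unary.Any.Properties as Any
open import Data.Product using (_×_; _,_)
open import Function using (_∘_; const)
open import Relation.Nullary using (contradiction)
open import Relation.Binary.PropositionalEquality
  using (_≡_; _≢_; refl; sym; trans; cong; cong₂; module ≡-Reasoning)

open ≡-Reasoning

deal : ℕ → (ℕ → Letter) → ℕ → List Bool → ℕ → ℕ
deal zero    p i bs       c = 0
deal (suc f) p i []       c = 0
deal (suc f) p i (b ∷ bs) c with p i
... | U = deal f p (suc i) (bs ++ [ b ]) c
... | D = if b then suc c else deal f p (suc i) bs (suc c)

run≡deal : ∀ f p i xs c → run f p i xs c ≡ deal f p i (map (_≡ᵇ 1) xs) c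
run≡deal zero    p i xs       c = refl
run≡deal (suc f) p i []       c = refl
run≡deal (suc f) p i (x ∷ xs) c with p i
... | U = trans (run≡deal f p (suc i) (xs ++ [ x ]) c)
                (cong (λ bs → deal f p (suc i) bs c) (map-++ (_≡ᵇ 1) xs [ x ]))
... | D with x ≡ᵇ 1
...   | true  = refl
...   | false = run≡deal f p (suc i) xs (suc c)

deal-U : ∀ {f} p i {b bs c} → p i ≡ U → deal (suc f) p i (b ∷ bs) c ≡ deal f p (suc i) (bs ++ [ b ]) c
deal-U p i eq rewrite eq = refl

deal-D-marked : ∀ {f} p i {bs c} → p i ≡ D → deal (suc f) p i (true ∷ bs) c ≡ suc c
deal-D-marked p i eq rewrite eq = refl

deal-fuel-mono : ∀ f k p i bs c → deal f p i bs c ≢ 0 → deal (f + k) p i bs c ≡ deal f p i bs c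
deal-fuel-mono zero    k p i bs       c nz = contradiction refl nz
deal-fuel-mono (suc f) k p i []       c nz = contradiction refl nz
deal-fuel-mono (suc f) k p i (b ∷ bs) c nz with p i
... | U = deal-fuel-mono f k p (suc i) (bs ++ [ b ]) c nz
... | D with b
...   | true  = refl
...   | false = deal-fuel-mono f k p (suc i) bs (suc c) nz

deal-fuel-irrelevant : ∀ f g p i bs c → deal f p i bs c ≢ 0 → deal g p i bs c ≢ 0 →
                       deal f p i bs c ≡ deal g p i bs c
deal-fuel-irrelevant f g p i bs c nzf nzg = begin
  deal f       p i bs c ≡⟨ sym (deal-fuel-mono f g p i bs c nzf) ⟩
  deal (f + g) p i bs c ≡⟨ cong (λ h → deal h p i bs c) (+-comm f g) ⟩
  deal (g + f) p i bs c ≡⟨ deal-fuel-mono g f p i bs c nzg ⟩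
  deal g       p i bs c ∎

deal-counter : ∀ f p i bs c d → deal f p i bs c ≢ 0 → deal f p i bs (c + d) ≡ deal f p i bs c + d
deal-counter zero    p i bs       c d nz = contradiction refl nz
deal-counter (suc f) p i []       c d nz = contradiction refl nz
deal-counter (suc f) p i (b ∷ bs) c d nz with p i
... | U = deal-counter f p (suc i) (bs ++ [ b ]) c d nz
... | D with b
...   | true  = refl
...   | false = deal-counter f p (suc i) bs (suc c) d nz

deal-shift : ∀ f p k i bs c → deal f p (k + i) bs c ≡ deal f (λ j → p (k + j)) i bs c
deal-shift zero    p k i bs       c = refl
deal-shift (suc f) p k i []       c = refl
deal-shift (suc f) p k i (b ∷ bs) c with p (k + i)
... | U rewrite sym (+-suc k i) = deal-shift f p k (suc i) (bs ++ [ b ]) c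
... | D with b
...   | true  = refl
...   | false rewrite sym (+-suc k i) = deal-shift f p k (suc i) bs (suc c)

indicator : Letter → Letter → ℕ
indicator U U = 1
indicator U D = 0
indicator D U = 0
indicator D D = 1

count : Letter → (ℕ → Letter) → ℕ → ℕ → ℕ
count x p i zero    = 0
count x p i (suc m) = indicator x (p i) + count x p (suc i) m

count-snoc : ∀ x p i m → count x p i (suc m) ≡ count x p i m + indicator x (p (i + m))
count-snoc x p i zero = trans (+-identityʳ _) (cong (indicator x ∘ p) (sym (+-identityʳ i)))
count-snoc x p i (suc m) = begin
  indicator x (p i) + count x p (suc i) (suc m)
    ≡⟨ cong (indicator x (p i) +_) (count-snoc x p (suc i) m) ⟩
  indicator x (p i) + (count x p (suc i) m + indicator x (p (suc i + m)))
    ≡⟨ sym (+-assoc (indicator x (p i)) _ _) ⟩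
  count x p i (suc m) + indicator x (p (suc (i + m)))
    ≡⟨ cong (λ j → count x p i (suc m) + indicator x (p j)) (sym (+-suc i m)) ⟩
  count x p i (suc m) + indicator x (p (i + suc m)) ∎

count-mono : ∀ x p i {m n} → m ≤ n → count x p i m ≤ count x p i n
count-mono x p i z≤n       = z≤n
count-mono x p i (s≤s m≤n) = +-monoʳ-≤ (indicator x (p i)) (count-mono x p (suc i) m≤n)

countD≡count : ∀ P n → countD P n ≡ count D (letter P) 0 n
countD≡count P zero = refl
countD≡count P (suc n) rewrite count-snoc D (letter P) 0 n | sym (countD≡count P n) with letter P n
... | D = +-comm 1 (countD P n)
... | U = sym (+-identityʳ (countD P n))

countU≡count : ∀ P n → countU P n ≡ count U (letter P) 0 n
countU≡count P zero = refl
countU≡count P (suc n) rewrite count-snoc U (letter P) 0 n | sym (countU≡count P n) with letter P n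
... | U = +-comm 1 (countU P n)
... | D = sym (+-identityʳ (countU P n))

afterDs-enough : ∀ Q n → n ≤ count D (letter Q) 0 (afterDs Q n)
afterDs-enough Q zero    = z≤n
afterDs-enough Q (suc k) with infD Q (afterDs Q k)
... | m , afterDs≤m , pm≡D = ≤-trans
  (s≤s (≤-trans (afterDs-enough Q k) (count-mono D (letter Q) 0 afterDs≤m)))
  (≤-reflexive (begin
    suc (count D (letter Q) 0 m)                    ≡⟨ +-comm 1 _ ⟩
    count D (letter Q) 0 m + indicator D D          ≡⟨ cong (λ x → count D (letter Q) 0 m + indicator D x) (sym pm≡D) ⟩
    count D (letter Q) 0 m + indicator D (letter Q m) ≡⟨ sym (count-snoc D (letter Q) 0 m) ⟩
    count D (letter Q) 0 (suc m)                    ∎))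

-- Until the marked card is dealt, each D shortens the deck by one and each U keeps its length.
deal≢0 : ∀ f p i bs c → true ∈ bs → length bs ≤ count D p i f → deal f p i bs c ≢ 0
deal≢0 zero    p i (b ∷ bs) c _ ()
deal≢0 (suc f) p i (b ∷ bs) c t∈ len≤ with p i
... | U = deal≢0 f p (suc i) (bs ++ [ b ]) c (Any.++-comm [ b ] bs t∈)
            (≤-trans (≤-reflexive (trans (length-++ bs) (+-comm _ 1))) len≤)
... | D with b | t∈
...   | true  | _          = λ ()
...   | false | there t∈bs = deal≢0 f p (suc i) bs (suc c) t∈bs (s≤s⁻¹ len≤)

deal-blank-prefix : ∀ p m f i ys c →
  deal (m + f) p i (replicate m false ++ ys) c ≡
  deal f p (i + m) (ys ++ replicate (count U p i m) false) (c + count D p i m)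
deal-blank-prefix p zero f i ys c
  rewrite +-identityʳ i | +-identityʳ c | ++-identityʳ ys = refl
deal-blank-prefix p (suc m) f i ys c with p i
... | U rewrite ++-assoc (replicate m false) ys [ false ]
              | deal-blank-prefix p m f (suc i) (ys ++ [ false ]) c
              | ++-assoc ys [ false ] (replicate (count U p (suc i) m) false)
              | +-suc i m = refl
... | D rewrite deal-blank-prefix p m f (suc i) ys (suc c)
              | +-suc i m | +-suc c (count D p (suc i) m) = refl

applyUpTo-const : ∀ {A : Set} (x : A) n → applyUpTo (const x) n ≡ replicate n x
applyUpTo-const x zero    = refl
applyUpTo-const x (suc n) = cong (x ∷_) (applyUpTo-const x n)

topMarked : ℕ → List Bool
topMarked n = true ∷ replicate n false

map-≡ᵇ1-deck : ∀ n → map (_≡ᵇ 1) (deck (suc n)) ≡ topMarked n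
map-≡ᵇ1-deck n = cong (true ∷_) (begin
  map (_≡ᵇ 1) (map suc (applyUpTo suc n)) ≡⟨ cong (map (_≡ᵇ 1)) (map-applyUpTo suc suc n) ⟩
  map (_≡ᵇ 1) (applyUpTo (suc ∘ suc) n)   ≡⟨ map-applyUpTo (suc ∘ suc) (_≡ᵇ 1) n ⟩
  applyUpTo (const false) n              ≡⟨ applyUpTo-const false n ⟩
  replicate n false                      ∎)

E≡deal : ∀ Q n → E Q (suc n) ≡ deal (afterDs Q (suc n)) (letter Q) 0 (topMarked n) 0
E≡deal Q n = trans (run≡deal (afterDs Q (suc n)) (letter Q) 0 (deck (suc n)) 0)
                   (cong (λ bs → deal (afterDs Q (suc n)) (letter Q) 0 bs 0) (map-≡ᵇ1-deck n))

deal-afterDs≢0 : ∀ Q n → deal (afterDs Q (suc n)) (letter Q) 0 (topMarked n) 0 ≢ 0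
deal-afterDs≢0 Q n = deal≢0 (afterDs Q (suc n)) (letter Q) 0 (topMarked n) 0 (here refl)
  (≤-trans (≤-reflexive (cong suc (length-replicate n))) (afterDs-enough Q (suc n)))

E≢0 : ∀ Q n → E Q (suc n) ≢ 0
E≢0 Q n eq = deal-afterDs≢0 Q n (trans (sym (E≡deal Q n)) eq)

E≡deal-anyFuel : ∀ Q n f → deal f (letter Q) 0 (topMarked n) 0 ≢ 0 →
                 E Q (suc n) ≡ deal f (letter Q) 0 (topMarked n) 0
E≡deal-anyFuel Q n f nz = trans (E≡deal Q n)
  (deal-fuel-irrelevant (afterDs Q (suc n)) f (letter Q) 0 (topMarked n) 0 (deal-afterDs≢0 Q n) nz)

E-topDealt : ∀ P n → letter P 0 ≡ D → E P (suc n) ≡ 1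
E-topDealt P n hD = trans (E≡deal P n) (deal-D-marked (letter P) 0 hD)

E-topPassed : ∀ P n → letter P 0 ≡ U →
              E P (suc n) ≡ E (dropP (suc n) P) (countU P (suc n)) + countD P (suc n)
E-topPassed P n hU = begin
  E P (suc n)                                 ≡⟨ E≡deal-anyFuel P n (suc n + F) dealing≢0 ⟩
  deal (suc n + F) p 0 (topMarked n) 0        ≡⟨ dealing ⟩
  E P′ (suc m) + d                            ≡⟨ cong₂ (λ u v → E P′ u + v) (sym countU≡) (sym countD≡) ⟩
  E P′ (countU P (suc n)) + countD P (suc n)  ∎
  where
  p = letter P
  P′ = dropP (suc n) P
  m = count U p 1 n
  d = count D p 1 n
  F = afterDs P′ (suc m)

  countU≡ : countU P (suc n) ≡ suc m
  countU≡ = trans (countU≡count P (suc n)) (cong (λ x → indicator U x + m) hU)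

  countD≡ : countD P (suc n) ≡ d
  countD≡ = trans (countD≡count P (suc n)) (cong (λ x → indicator D x + d) hU)

  dealing : deal (suc n + F) p 0 (topMarked n) 0 ≡ E P′ (suc m) + d
  dealing = begin
    deal (suc n + F) p 0 (topMarked n) 0                ≡⟨ deal-U p 0 hU ⟩
    deal (n + F) p 1 (replicate n false ++ [ true ]) 0  ≡⟨ deal-blank-prefix p n F 1 [ true ] 0 ⟩
    deal F p (suc n) (topMarked m) d                    ≡⟨ cong (λ k → deal F p k (topMarked m) d) (sym (+-identityʳ (suc n))) ⟩
    deal F p (suc n + 0) (topMarked m) d                ≡⟨ deal-shift F p (suc n) 0 (topMarked m) d ⟩
    deal F (letter P′) 0 (topMarked m) (0 + d)          ≡⟨ deal-counter F (letter P′) 0 (topMarked m) 0 d (deal-afterDs≢0 P′ m) ⟩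
    deal F (letter P′) 0 (topMarked m) 0 + d            ≡⟨ cong (_+ d) (sym (E≡deal P′ m)) ⟩
    E P′ (suc m) + d                                    ∎

  dealing≢0 : deal (suc n + F) p 0 (topMarked n) 0 ≢ 0
  dealing≢0 eq = E≢0 P′ m (m+n≡0⇒m≡0 _ (trans (sym dealing) eq))

mainTheorem11 : (P : Pattern) (N : ℕ) → N ≥ 1 →
    (letter P 0 ≡ D → E P N ≡ 1) ×
    (letter P 0 ≡ U → E P N ≡ E (dropP N P) (countU P N) + countD P N)
mainTheorem11 P (suc n) _ = E-topDealt P n , E-topPassed P n
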